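{- Let $n\geq 3$ be an integer and let $p_1,\ldots,p_s$ be the odd prime numbers less than or equal to $n$. Then there exist integers $\alpha\geq 0$ and $\alpha_1,\ldots,\alpha_s\geq 1$ such that $$n! = 2^{\alpha}\, p_1^{\alpha_1}(p_1-1)\cdots p_s^{\alpha_s}(p_s-1).$$ -}

module Defs where

open import Data.Nat using (ℕ; suc; _*_; _^_; _∸_; _≤_)
open import Data.Nat.Primality using (Prime; prime?)
open import Data.List using (List; []; _∷_; filter; upTo; foldr)
open import Data.Product using (_×_)
open import Relation.Nullary using (¬_)
open import Relation.Nullary.Decidable using (_×-dec_; ¬?)
open import Relation.Binary.PropositionalEquality using (_≡_)
open import Data.Nat using (_≟_)

OddPrime : ℕ → Set
OddPrime p = Prime p × ¬ (p ≡ 2)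

oddPrimesUpTo : ℕ → List ℕ
oddPrimesUpTo n = filter (λ p → prime? p ×-dec ¬? (p ≟ 2)) (upTo (suc n))

primeFactorProduct : List ℕ → List ℕ → ℕ
primeFactorProduct (p ∷ ps) (a ∷ as) = (p ^ a) * (p ∸ 1) * primeFactorProduct ps as
primeFactorProduct _        _        = 1

module Submission where

-- Write n! = 1·2·…·n and pair every odd prime p ≤ n with its
-- predecessor p − 1, which also occurs in the product and is not itself an
-- odd prime.  The paired factors give  ∏ p (p − 1)  over the odd primes
-- p ≤ n; every remaining factor m ≤ n is n-smooth (all its prime factors
-- are ≤ n), and so is their product.  An n-smooth number has the normal
-- form  2^α · p₁^e₁ ⋯ pₛ^eₛ, and multiplying it by ∏ pᵢ (pᵢ − 1) yields the
-- required shape with exponents αᵢ = eᵢ + 1 ≥ 1.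

open import Defs
open import Data.Nat using (ℕ; _≤_; _*_; _^_; _!)
open import Data.List using (List; length)
open import Data.List.Relation.Unary.All using (All)
open import Data.Product using (Σ; _×_)
open import Relation.Binary.PropositionalEquality using (_≡_)

open import Data.Nat using (zero; suc; _+_; _∸_; _<_; z≤n; s≤s; _≟_; nonTrivial⇒n>1)
open import Data.Nat.Properties
open import Data.Nat.Induction using (<-rec)
open import Data.Nat.ListAction using (product)
open import Data.Nat.ListAction.Properties using (product-++)
open import Data.Nat.Divisibility using (_∣_; divides; quotient; m∣n⇒n≡m*quotient; quotient>1; quotient-<)
open import Data.Nat.Divisibility.Core using (hasNonTrivialDivisor)
open import Data.Nat.Primality using (Prime; prime?; prime⇒irreducible; ¬prime⇒composite; ¬prime[1])
open import Data.List using ([]; _∷_; _++_; [_]; filter; upTo; map; zipWith; replicate)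
open import Data.List.Properties using (filter-++; upTo-∷ʳ; filter-accept; filter-reject; ++-identityʳ; length-map; length-replicate; map-++)
open import Data.List.Membership.Propositional using (_∈_)
open import Data.List.Membership.Propositional.Properties using (∈-filter⁺; ∈-upTo⁺)
open import Data.List.Relation.Unary.Any using (here; there)
open import Data.List.Relation.Unary.All using (universal)
open import Data.List.Relation.Unary.All.Properties using (map⁺)
open import Data.Product using (_,_)
open import Data.Sum using (_⊎_; inj₁; inj₂)
open import Relation.Nullary using (¬_; Dec; yes; no; contradiction)
open import Relation.Nullary.Decidable using (_×-dec_; ¬?)
open import Relation.Unary using (Decidable)
open import Relation.Binary.PropositionalEquality using (refl; sym; trans; cong; cong₂; subst; module ≡-Reasoning)
open import Algebra.Properties.CommutativeSemigroup *-commutativeSemigroup using (interchange; xy∙z≈xz∙y)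
open import Data.Nat.Solver using (module +-*-Solver)
open +-*-Solver using (solve; _:*_; _:=_; con)

oddPrime? : Decidable OddPrime
oddPrime? p = prime? p ×-dec ¬? (p ≟ 2)

even-or-odd : ∀ m → 2 ∣ m ⊎ 2 ∣ suc m
even-or-odd zero = inj₁ (divides 0 refl)
even-or-odd (suc m) with even-or-odd m
... | inj₁ (divides q m≡q*2) = inj₂ (divides (suc q) (cong (λ k → suc (suc k)) m≡q*2))
... | inj₂ 2∣1+m             = inj₁ 2∣1+m

even-prime : ∀ {p} → Prime p → 2 ∣ p → p ≡ 2
even-prime pr 2∣p with prime⇒irreducible pr 2∣p
... | inj₁ ()
... | inj₂ 2≡p = sym 2≡p

-- Two consecutive numbers are never both odd primes: the even one of m and
-- m + 1 would be 2, which is excluded for m and would make m = 1 for m + 1.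
oddPrime-suc : ∀ {m} → OddPrime m → ¬ OddPrime (suc m)
oddPrime-suc {m} (pr[m] , m≢2) (pr[1+m] , _) with even-or-odd m
... | inj₁ 2∣m   = m≢2 (even-prime pr[m] 2∣m)
... | inj₂ 2∣1+m with even-prime pr[1+m] 2∣1+m
...   | refl = ¬prime[1] pr[m]

oddPrimesUpTo-complete : ∀ {n p} → OddPrime p → p ≤ n → p ∈ oddPrimesUpTo n
oddPrimesUpTo-complete op p≤n = ∈-filter⁺ oddPrime? (∈-upTo⁺ (s≤s p≤n)) op

oddPrimesUpTo-suc : ∀ n → oddPrimesUpTo (suc n) ≡ oddPrimesUpTo n ++ filter oddPrime? [ suc n ]
oddPrimesUpTo-suc n =
  trans (cong (filter oddPrime?) (sym (upTo-∷ʳ (suc n))))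
        (filter-++ oddPrime? (upTo (suc n)) [ suc n ])

oddPrimesUpTo-suc-yes : ∀ {n} → OddPrime (suc n) → oddPrimesUpTo (suc n) ≡ oddPrimesUpTo n ++ [ suc n ]
oddPrimesUpTo-suc-yes {n} op =
  trans (oddPrimesUpTo-suc n) (cong (oddPrimesUpTo n ++_) (filter-accept oddPrime? op))

oddPrimesUpTo-suc-no : ∀ {n} → ¬ OddPrime (suc n) → oddPrimesUpTo (suc n) ≡ oddPrimesUpTo n
oddPrimesUpTo-suc-no {n} ¬op =
  trans (oddPrimesUpTo-suc n)
        (trans (cong (oddPrimesUpTo n ++_) (filter-reject oddPrime? ¬op)) (++-identityʳ _))

data Smooth (n : ℕ) : ℕ → Set where
  one   : Smooth n 1
  prime : ∀ {p} → Prime p → p ≤ n → Smooth n p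
  _·_   : ∀ {x y} → Smooth n x → Smooth n y → Smooth n (x * y)

smooth-mono : ∀ {n n′ x} → n ≤ n′ → Smooth n x → Smooth n′ x
smooth-mono n≤n′ one            = one
smooth-mono n≤n′ (prime pr p≤n) = prime pr (≤-trans p≤n n≤n′)
smooth-mono n≤n′ (s · t)        = smooth-mono n≤n′ s · smooth-mono n≤n′ t

smooth-≤ : ∀ {n m} → 1 ≤ m → m ≤ n → Smooth n m
smooth-≤ {n} {m} = <-rec (λ m → 1 ≤ m → m ≤ n → Smooth n m) step m
  where
  step : ∀ m → (∀ {k} → k < m → 1 ≤ k → k ≤ n → Smooth n k) → 1 ≤ m → m ≤ n → Smooth n m
  step 1               _  _ _   = one
  step m@(suc (suc _)) ih _ m≤n with prime? m
  ... | yes pr = prime pr m≤n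
  ... | no ¬pr with ¬prime⇒composite ¬pr
  ...   | hasNonTrivialDivisor {d} d<m d∣m =
    subst (Smooth n) (sym (m∣n⇒n≡m*quotient d∣m))
      (ih d<m (<⇒≤ (nonTrivial⇒n>1 d)) (≤-trans (<⇒≤ d<m) m≤n) ·
       ih q<m (<⇒≤ (quotient>1 d∣m d<m)) (≤-trans (<⇒≤ q<m) m≤n))
    where
    q<m : quotient d∣m < m
    q<m = quotient-< d∣m

powerProduct : List ℕ → List ℕ → ℕ
powerProduct (p ∷ ps) (e ∷ es) = p ^ e * powerProduct ps es
powerProduct _        _        = 1

NormalForm : List ℕ → ℕ → Set
NormalForm Ls x = Σ ℕ λ α → Σ (List ℕ) λ es →
  (length es ≡ length Ls) × (x ≡ 2 ^ α * powerProduct Ls es)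

powerProduct-zeros : ∀ Ls → powerProduct Ls (replicate (length Ls) 0) ≡ 1
powerProduct-zeros []       = refl
powerProduct-zeros (p ∷ ps) = trans (+-identityʳ _) (powerProduct-zeros ps)

powerProduct-+ : ∀ Ls es fs → length es ≡ length Ls → length fs ≡ length Ls →
  powerProduct Ls (zipWith _+_ es fs) ≡ powerProduct Ls es * powerProduct Ls fs
powerProduct-+ []       []       []       _  _  = refl
powerProduct-+ (p ∷ ps) (e ∷ es) (f ∷ fs) le lf = begin
  p ^ (e + f) * powerProduct ps (zipWith _+_ es fs)
    ≡⟨ cong₂ _*_ (^-distribˡ-+-* p e f) (powerProduct-+ ps es fs (suc-injective le) (suc-injective lf)) ⟩
  p ^ e * p ^ f * (powerProduct ps es * powerProduct ps fs)
    ≡⟨ interchange (p ^ e) (p ^ f) _ _ ⟩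
  p ^ e * powerProduct ps es * (p ^ f * powerProduct ps fs) ∎
  where open ≡-Reasoning

length-zipWith-+ : ∀ (es fs : List ℕ) {k} → length es ≡ k → length fs ≡ k → length (zipWith _+_ es fs) ≡ k
length-zipWith-+ []       []       le _  = le
length-zipWith-+ (e ∷ es) (f ∷ fs) {suc k} le lf =
  cong suc (length-zipWith-+ es fs (suc-injective le) (suc-injective lf))
length-zipWith-+ []       (_ ∷ _) refl ()
length-zipWith-+ (_ ∷ _) []       refl ()

nf-1 : ∀ Ls → NormalForm Ls 1
nf-1 Ls = 0 , replicate (length Ls) 0 , length-replicate (length Ls) , sym (trans (+-identityʳ _) (powerProduct-zeros Ls))

nf-2 : ∀ Ls → NormalForm Ls 2
nf-2 Ls = 1 , replicate (length Ls) 0 , length-replicate (length Ls) , sym (cong (2 *_) (powerProduct-zeros Ls))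

nf-∈ : ∀ {Ls q} → q ∈ Ls → NormalForm Ls q
nf-∈ {q ∷ ps} (here refl) =
  0 , 1 ∷ replicate (length ps) 0 , cong suc (length-replicate (length ps)) ,
  sym (trans (+-identityʳ _) (trans (cong (q ^ 1 *_) (powerProduct-zeros ps)) (trans (*-identityʳ _) (*-identityʳ q))))
nf-∈ {p ∷ ps} (there q∈ps) with nf-∈ q∈ps
... | α , es , le , q≡ = α , 0 ∷ es , cong suc le , trans q≡ (cong (2 ^ α *_) (sym (+-identityʳ _)))

nf-* : ∀ Ls {x y} → NormalForm Ls x → NormalForm Ls y → NormalForm Ls (x * y)
nf-* Ls {x} {y} (a , es , le , x≡) (b , fs , lf , y≡) =
  a + b , zipWith _+_ es fs , length-zipWith-+ es fs le lf , (begin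
    x * y                                                       ≡⟨ cong₂ _*_ x≡ y≡ ⟩
    2 ^ a * powerProduct Ls es * (2 ^ b * powerProduct Ls fs)   ≡⟨ interchange (2 ^ a) _ (2 ^ b) _ ⟩
    2 ^ a * 2 ^ b * (powerProduct Ls es * powerProduct Ls fs)
      ≡⟨ cong₂ _*_ (sym (^-distribˡ-+-* 2 a b)) (sym (powerProduct-+ Ls es fs le lf)) ⟩
    2 ^ (a + b) * powerProduct Ls (zipWith _+_ es fs) ∎)
  where open ≡-Reasoning

normalForm : ∀ {n x} → Smooth n x → NormalForm (oddPrimesUpTo n) x
normalForm {n} one = nf-1 (oddPrimesUpTo n)
normalForm {n} (prime {p} pr p≤n) with p ≟ 2
... | yes refl = nf-2 (oddPrimesUpTo n)
... | no p≢2   = nf-∈ (oddPrimesUpTo-complete (pr , p≢2) p≤n)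
normalForm {n} (s · t) = nf-* (oddPrimesUpTo n) (normalForm s) (normalForm t)

pair : ℕ → ℕ
pair p = p * (p ∸ 1)

pairedProduct : List ℕ → ℕ
pairedProduct Ls = product (map pair Ls)

pairedProduct-++ : ∀ Ls Ms → pairedProduct (Ls ++ Ms) ≡ pairedProduct Ls * pairedProduct Ms
pairedProduct-++ Ls Ms = trans (cong product (map-++ pair Ls Ms)) (product-++ (map pair Ls) (map pair Ms))

-- The factor n of n! is held back when n + 1 is an odd prime, to be paired
-- with n + 1 at the next step.
pending : ℕ → ℕ
pending n with oddPrime? (suc n)
... | yes _ = n
... | no _  = 1

pending-yes : ∀ {n} → OddPrime (suc n) → pending n ≡ n
pending-yes {n} op with oddPrime? (suc n)
... | yes _  = refl
... | no ¬op = contradiction op ¬op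

pending-no : ∀ {n} → ¬ OddPrime (suc n) → pending n ≡ 1
pending-no {n} ¬op with oddPrime? (suc n)
... | yes op = contradiction op ¬op
... | no _   = refl

FactorialSplit : ℕ → Set
FactorialSplit n = Σ ℕ λ G → Smooth n G × (n ! ≡ G * pairedProduct (oddPrimesUpTo n) * pending n)

factorial-step : ∀ n → FactorialSplit n → Dec (OddPrime (suc n)) → Dec (OddPrime (suc (suc n))) →
  FactorialSplit (suc n)
factorial-step n _ (yes op) (yes op′) = contradiction op′ (oddPrime-suc op)
-- n + 1 is an odd prime: pair it with the held-back factor n.
factorial-step n (G , sG , n!≡) (yes op) (no ¬op′) = G , smooth-mono (n≤1+n n) sG , (begin
  suc n * n !                               ≡⟨ cong (suc n *_) (trans n!≡ (cong (G * P *_) (pending-yes op))) ⟩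
  suc n * (G * P * n)                       ≡⟨ solve 4 (λ s g p m → s :* (g :* p :* m) := g :* (p :* (s :* m :* con 1)) :* con 1) refl (suc n) G P n ⟩
  G * (P * pairedProduct [ suc n ]) * 1     ≡⟨ cong (λ Q → G * Q * 1) (sym (pairedProduct-++ (oddPrimesUpTo n) [ suc n ])) ⟩
  G * pairedProduct (oddPrimesUpTo n ++ [ suc n ]) * 1
                                            ≡⟨ cong₂ (λ Ls e → G * pairedProduct Ls * e) (sym (oddPrimesUpTo-suc-yes op)) (sym (pending-no ¬op′)) ⟩
  G * pairedProduct (oddPrimesUpTo (suc n)) * pending (suc n) ∎)
  where
  open ≡-Reasoning
  P : ℕ
  P = pairedProduct (oddPrimesUpTo n)
-- n + 2 is an odd prime: hold back n + 1.
factorial-step n (G , sG , n!≡) (no ¬op) (yes op′) = G , smooth-mono (n≤1+n n) sG , (begin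
  suc n * n !            ≡⟨ cong (suc n *_) (trans n!≡ (cong (G * P *_) (pending-no ¬op))) ⟩
  suc n * (G * P * 1)    ≡⟨ solve 3 (λ s g p → s :* (g :* p :* con 1) := g :* p :* s) refl (suc n) G P ⟩
  G * P * suc n          ≡⟨ cong₂ (λ Ls e → G * pairedProduct Ls * e) (sym (oddPrimesUpTo-suc-no ¬op)) (sym (pending-yes op′)) ⟩
  G * pairedProduct (oddPrimesUpTo (suc n)) * pending (suc n) ∎)
  where
  open ≡-Reasoning
  P : ℕ
  P = pairedProduct (oddPrimesUpTo n)
-- otherwise n + 1 is an unpaired factor and joins the smooth part.
factorial-step n (G , sG , n!≡) (no ¬op) (no ¬op′) =
  G * suc n , smooth-mono (n≤1+n n) sG · smooth-≤ (s≤s z≤n) ≤-refl , (begin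
  suc n * n !            ≡⟨ cong (suc n *_) (trans n!≡ (cong (G * P *_) (pending-no ¬op))) ⟩
  suc n * (G * P * 1)    ≡⟨ solve 3 (λ s g p → s :* (g :* p :* con 1) := g :* s :* p :* con 1) refl (suc n) G P ⟩
  G * suc n * P * 1      ≡⟨ cong₂ (λ Ls e → G * suc n * pairedProduct Ls * e) (sym (oddPrimesUpTo-suc-no ¬op)) (sym (pending-no ¬op′)) ⟩
  G * suc n * pairedProduct (oddPrimesUpTo (suc n)) * pending (suc n) ∎)
  where
  open ≡-Reasoning
  P : ℕ
  P = pairedProduct (oddPrimesUpTo n)

factorial-split : ∀ n → FactorialSplit n
factorial-split zero    = 1 , one , refl
factorial-split (suc n) = factorial-step n (factorial-split n) (oddPrime? (suc n)) (oddPrime? (suc (suc n)))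

pending-smooth : ∀ {n} → 1 ≤ n → Smooth n (pending n)
pending-smooth {n} 1≤n with oddPrime? (suc n)
... | yes _ = smooth-≤ 1≤n ≤-refl
... | no _  = one

primeFactorProduct-split : ∀ Ls es → length es ≡ length Ls →
  primeFactorProduct Ls (map suc es) ≡ powerProduct Ls es * pairedProduct Ls
primeFactorProduct-split []       []       _  = refl
primeFactorProduct-split (p ∷ ps) (e ∷ es) le = begin
  p * p ^ e * (p ∸ 1) * primeFactorProduct ps (map suc es)
    ≡⟨ cong (p * p ^ e * (p ∸ 1) *_) (primeFactorProduct-split ps es (suc-injective le)) ⟩
  p * p ^ e * (p ∸ 1) * (powerProduct ps es * pairedProduct ps)
    ≡⟨ solve 5 (λ a b c d f → a :* b :* c :* (d :* f) := b :* d :* (a :* c :* f)) refl p (p ^ e) (p ∸ 1) (powerProduct ps es) (pairedProduct ps) ⟩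
  p ^ e * powerProduct ps es * (p * (p ∸ 1) * pairedProduct ps) ∎
  where open ≡-Reasoning

mainTheorem7 : (n : ℕ) → 3 ≤ n →
    Σ ℕ λ α → Σ (List ℕ) λ αs →
    (length αs ≡ length (oddPrimesUpTo n)) × All (1 ≤_) αs ×
    (n ! ≡ 2 ^ α * primeFactorProduct (oddPrimesUpTo n) αs)
mainTheorem7 n 3≤n with factorial-split n
... | G , sG , n!≡ with normalForm (sG · pending-smooth (≤-trans (s≤s z≤n) 3≤n))
... | α , es , le , G·e≡ =
  α , map suc es , trans (length-map suc es) le , map⁺ (universal (λ _ → s≤s z≤n) es) , (begin
    n !                                   ≡⟨ n!≡ ⟩
    G * P * pending n                     ≡⟨ xy∙z≈xz∙y G P (pending n) ⟩
    G * pending n * P                     ≡⟨ cong (_* P) G·e≡ ⟩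
    2 ^ α * powerProduct Ls es * P        ≡⟨ *-assoc (2 ^ α) _ P ⟩
    2 ^ α * (powerProduct Ls es * P)      ≡⟨ cong (2 ^ α *_) (sym (primeFactorProduct-split Ls es le)) ⟩
    2 ^ α * primeFactorProduct Ls (map suc es) ∎)
  where
  open ≡-Reasoning
  Ls : List ℕ
  Ls = oddPrimesUpTo n
  P : ℕ
  P = pairedProduct Ls
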